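{- Every regular process can be specified in $\mathrm{TCP}^{\natural}$ modulo divergence-preserving branching bisimilarity: given a finite action set $\mathcal{A}_\tau$ and a regular specification $P_i=\sum_{j=1}^{n}\alpha_{ij}\bullet P_j+\beta_i$ ($i=1,\ldots,n$), where each $\alpha_{ij}$ and $\beta_i$ is a finite sum of actions from $\mathcal{A}_\tau$ possibly with a $\mathbf{1}$-summand, for every $i$ there is a closed $\mathrm{TCP}^{\natural}$ process expression $Q_i$ (which may use, besides actions from $\mathcal{A}_\tau$, communication actions on a channel not occurring in $\mathcal{A}_\tau$) such that $P_i$ and $Q_i$ are divergence-preserving branching bisimilar.
   Context: $\tau\in\mathcal{A}_\tau$ is the internal action; an action $a$ used as a process abbreviates $a.\mathbf{1}$. Communication actions are $c?d$ and $c!d$ for channels $c$ and data $d$; $\mathcal{I}_{\mathcal{C}'}=\{c?d,c!d\mid c\in\mathcal{C}'\}$. $\mathrm{TCP}^{\natural}$ expressions (no recursion): $P::=\mathbf{0}\mid\mathbf{1}\mid a.P\mid P\bullet P\mid P+P\mid[P\parallel P]_{\mathcal{C}'}\mid P^*\mid P\,\sharp\,P$. Operational semantics (structural; negative premise well-defined): $\mathbf{1}\downarrow$; $a.P\xrightarrow{a}P$; $+$ inherits transitions and termination from either summand; names $P_i$ of the regular specification have the transitions and termination of their right-hand sides; $P_1\bullet P_2\downarrow$ if both terminate; $P_1\xrightarrow{a}P_1'$ implies $P_1\bullet P_2\xrightarrow{a}P_1'\bullet P_2$; if $P_1\downarrow$, $P_2\xrightarrow{a}P_2'$ and $P_1$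 has no outgoing transition then $P_1\bullet P_2\xrightarrow{a}P_2'$; $[P_1\parallel P_2]_{\mathcal{C}'}\xrightarrow{a}[P_1'\parallel P_2]_{\mathcal{C}'}$ if $P_1\xrightarrow{a}P_1'$, $a\notin\mathcal{I}_{\mathcal{C}'}$ (symmetrically for $P_2$); $[P_1\parallel P_2]_{\mathcal{C}'}\downarrow$ if both terminate; $[P_1\parallel P_2]_{\mathcal{C}'}\xrightarrow{\tau}[P_1'\parallel P_2']_{\mathcal{C}'}$ if $c\in\mathcal{C}'$ and one component does $c?d$, the other $c!d$; $P^*\downarrow$; $P\xrightarrow{a}P'$ implies $P^*\xrightarrow{a}P'\bullet P^*$; $P_1\xrightarrow{a}P_1'$ implies $P_1\sharp P_2\xrightarrow{a}P_1'\bullet(P_1\sharp P_2)\bullet P_1$; $P_2\xrightarrow{a}P_2'$ implies $P_1\sharp P_2\xrightarrow{a}P_2'$; $P_2\downarrow$ implies $P_1\sharp P_2\downarrow$. Divergence-preserving branching bisimulation: write $s\xrightarrow{(a)}t$ for "$s\xrightarrow{a}t$ or ($a=\tau$ and $s=t$)", $\to^*$, $\to^+$ for reflexive-transitive and transitive closures of $\xrightarrow{\tau}$; a symmetric relation $R$ such that $sRt$ implies (1) if $s\xrightarrow{a}s'$ then $t\to^*t''\xrightarrow{(a)}t'$ with $sRt''$, $s'Rt'$; (2) if $s\downarrow$ then $t\to^*t'$ with $t'\downarrow$, $sRt'$; (3) if $s=s_0\xrightarrow{\tau}s_1\xrightarrow{\tau}\cdots$ is infinite with $s_iRt$ for all $i$,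 then $t\to^+t'$ with $s_iRt'$ for some $i$. States are divergence-preserving branching bisimilar if related by some such $R$. -}

module Defs where

open import Data.Nat using (ℕ; zero; suc)
open import Data.Fin using (Fin)
open import Data.List using (List; []; _∷_; allFin)
open import Data.Maybe using (Maybe; just; nothing)
open import Data.Product using (Σ; _×_; _,_)
open import Data.Sum using (_⊎_)
open import Data.Empty using (⊥)
open import Data.Unit using (⊤)
open import Relation.Nullary using (¬_)
open import Relation.Binary.PropositionalEquality using (_≡_)
open import Data.List.Membership.Propositional using (_∈_)
open import Data.List.Relation.Unary.All using (All)
open import Relation.Binary.Construct.Closure.ReflexiveTransitive using (Star)

Chan : Set
Chan = ℕ

Datum : Set
Datum = ℕ

data Act : Set where
  τ   : Act
  act : ℕ → Act
  rcv : Chan → Datum → Act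
  snd : Chan → Datum → Act

InI : List Chan → Act → Set
InI C a = Σ Chan λ c → c ∈ C × Σ Datum λ d → (a ≡ rcv c d ⊎ a ≡ snd c d)

OnChan : Chan → Act → Set
OnChan c a = Σ Datum λ d → (a ≡ rcv c d ⊎ a ≡ snd c d)

FreshChan : Chan → List Act → Set
FreshChan c A = ∀ d → ¬ (rcv c d ∈ A) × ¬ (snd c d ∈ A)

infixr 6 _⊕_
infixr 7 _•_
infixr 8 _∙_
infixr 7 _♯_

data Term : Set where
  𝟎    : Term
  𝟏    : Term
  _∙_  : Act → Term → Term
  _•_  : Term → Term → Term
  _⊕_  : Term → Term → Term
  par  : List Chan → Term → Term → Term
  _*   : Term → Term
  _♯_  : Term → Term → Term

_↓ : Term → Set
𝟎 ↓ = ⊥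
𝟏 ↓ = ⊤
(a ∙ P) ↓ = ⊥
(P • Q) ↓ = P ↓ × Q ↓
(P ⊕ Q) ↓ = P ↓ ⊎ Q ↓
par C P Q ↓ = P ↓ × Q ↓
(P *) ↓ = ⊤
(P ♯ Q) ↓ = Q ↓

-- transitions  P —a→ R ; defined by recursion on the source term, which is
-- a stratification making the negative premise (for •) well-defined.
Step : Term → Act → Term → Set
Step 𝟎 b R = ⊥
Step 𝟏 b R = ⊥
Step (a ∙ P) b R = (b ≡ a) × (R ≡ P)
Step (P • Q) b R =
    (Σ Term λ P₁ → Step P b P₁ × R ≡ P₁ • Q)
  ⊎ (P ↓ × ¬ (Σ Act λ c → Σ Term λ P₁ → Step P c P₁) × Step Q b R)
Step (P ⊕ Q) b R = Step P b R ⊎ Step Q b R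
Step (par C P Q) b R =
    (Σ Term λ P₁ → Step P b P₁ × ¬ InI C b × R ≡ par C P₁ Q)
  ⊎ (Σ Term λ Q₁ → Step Q b Q₁ × ¬ InI C b × R ≡ par C P Q₁)
  ⊎ (b ≡ τ × Σ Chan λ c → c ∈ C × Σ Datum λ d → Σ Term λ P₁ → Σ Term λ Q₁ →
       ((Step P (rcv c d) P₁ × Step Q (snd c d) Q₁)
        ⊎ (Step P (snd c d) P₁ × Step Q (rcv c d) Q₁))
       × R ≡ par C P₁ Q₁)
Step (P *) b R = Σ Term λ P₁ → Step P b P₁ × R ≡ P₁ • (P *)
Step (P ♯ Q) b R =
    (Σ Term λ P₁ → Step P b P₁ × R ≡ P₁ • ((P ♯ Q) • P))
  ⊎ Step Q b R

UsesOnly : (Act → Set) → Term → Set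
UsesOnly Ok 𝟎 = ⊤
UsesOnly Ok 𝟏 = ⊤
UsesOnly Ok (a ∙ P) = Ok a × UsesOnly Ok P
UsesOnly Ok (P • Q) = UsesOnly Ok P × UsesOnly Ok Q
UsesOnly Ok (P ⊕ Q) = UsesOnly Ok P × UsesOnly Ok Q
UsesOnly Ok (par C P Q) = UsesOnly Ok P × UsesOnly Ok Q
UsesOnly Ok (P *) = UsesOnly Ok P
UsesOnly Ok (P ♯ Q) = UsesOnly Ok P × UsesOnly Ok Q

-- Finite sums of actions, possibly with 1-summands
-- (nothing = the summand 1, just a = the summand a, i.e. a.1)

summand : Maybe Act → Term
summand nothing = 𝟏
summand (just a) = a ∙ 𝟏

sumTerm : List (Maybe Act) → Term
sumTerm [] = 𝟎
sumTerm (x ∷ []) = summand x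
sumTerm (x ∷ y ∷ xs) = summand x ⊕ sumTerm (y ∷ xs)

FromA : List Act → Maybe Act → Set
FromA A nothing = ⊤
FromA A (just a) = a ∈ A

-- Terms of the regular specification: names P_i, closed TCP♮ terms,
-- closed-term • spec-term, and +.  (Exactly the fragment reachable from
-- the names; its rules are the TCP♮ rules for these operators.)

data STerm (n : ℕ) : Set where
  name : Fin n → STerm n
  cl   : Term → STerm n
  _⊙_  : Term → STerm n → STerm n
  _⊞_  : STerm n → STerm n → STerm n

record RegSpec (A : List Act) (n : ℕ) : Set where
  field
    α    : Fin n → Fin n → List (Maybe Act)
    β    : Fin n → List (Maybe Act)
    α-ok : ∀ i j → All (FromA A) (α i j)
    β-ok : ∀ i → All (FromA A) (β i)

  sumFrom : Fin n → List (Fin n) → STerm n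
  sumFrom i [] = cl (sumTerm (β i))
  sumFrom i (j ∷ js) = (sumTerm (α i j) ⊙ name j) ⊞ sumFrom i js

  rhs : Fin n → STerm n
  rhs i = sumFrom i (allFin n)

module SpecSem {n : ℕ} (rhs : Fin n → STerm n) where

  data _↓ₛ : STerm n → Set where
    cl↓   : ∀ {P} → P ↓ → cl P ↓ₛ
    name↓ : ∀ {i} → rhs i ↓ₛ → name i ↓ₛ
    seq↓  : ∀ {P S} → P ↓ → S ↓ₛ → (P ⊙ S) ↓ₛ
    suml↓ : ∀ {S T} → S ↓ₛ → (S ⊞ T) ↓ₛ
    sumr↓ : ∀ {S T} → T ↓ₛ → (S ⊞ T) ↓ₛ

  data Stepₛ : STerm n → Act → STerm n → Set where
    cl-step   : ∀ {P a P'} → Step P a P' → Stepₛ (cl P) a (cl P')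
    name-step : ∀ {i a S'} → Stepₛ (rhs i) a S' → Stepₛ (name i) a S'
    seq-l     : ∀ {P a P' S} → Step P a P' → Stepₛ (P ⊙ S) a (P' ⊙ S)
    seq-r     : ∀ {P a S S'} → P ↓ → ¬ (Σ Act λ c → Σ Term λ P₁ → Step P c P₁) →
                Stepₛ S a S' → Stepₛ (P ⊙ S) a S'
    sum-l     : ∀ {S T a S'} → Stepₛ S a S' → Stepₛ (S ⊞ T) a S'
    sum-r     : ∀ {S T a T'} → Stepₛ T a T' → Stepₛ (S ⊞ T) a T'

module DPBB {St : Set} (_⟶[_]_ : St → Act → St → Set) (Trm : St → Set) where

  _⇾_ : St → St → Set
  s ⇾ t = s ⟶[ τ ] t

  _⇾*_ : St → St → Set
  _⇾*_ = Star _⇾_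

  _⇾⁺_ : St → St → Set
  s ⇾⁺ t = Σ St λ u → s ⇾ u × u ⇾* t

  record IsDPBB (R : St → St → Set) : Set where
    field
      symm : ∀ {s t} → R s t → R t s
      step : ∀ {s t a s'} → R s t → s ⟶[ a ] s' →
             Σ St λ t'' → Σ St λ t' → t ⇾* t'' ×
               (t'' ⟶[ a ] t' ⊎ (a ≡ τ × t'' ≡ t')) × R s t'' × R s' t'
      term : ∀ {s t} → R s t → Trm s →
             Σ St λ t' → t ⇾* t' × Trm t' × R s t'
      div  : ∀ {s t} → R s t → (f : ℕ → St) → f zero ≡ s →
             (∀ k → f k ⇾ f (suc k)) → (∀ k → R (f k) t) →
             Σ St λ t' → t ⇾⁺ t' × Σ ℕ λ k → R (f k) t'

  _≈_ : St → St → Set₁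
  s ≈ t = Σ (St → St → Set) λ R → IsDPBB R × R s t

Bisim : ∀ {A n} → RegSpec A n → STerm n → STerm n → Set₁
Bisim E = DPBB._≈_ Stepₛ _↓ₛ
  where open SpecSem (RegSpec.rhs E)

-- Q_i is [Body_i • control* ∥ 𝟏 • register*] on a fresh channel c, with control = Σ_k c?k.Body_k
-- and register = Σ_k c?k.c!k.  Body_i is a finite sum offering exactly the transitions of P_i, a
-- transition to 𝟏 • P_j being continued by c!j, and terminating iff P_i does.  Since a prefix
-- α_ij made of 𝟏-summands is passed silently, these transitions and the termination of P_i are
-- collected along chains of such prefixes: a finite reachability closure over the names.  The
-- register echoes c!j back to control, which then continues as Body_j; the two τ-steps this costs
-- pass through states with no other transitions, so they are inert and cannot diverge.

module Submission where

open import Defs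
open import Data.Nat using (ℕ; zero; suc; _≤_; s≤s⁻¹)
open import Data.Nat.Properties using (≤-trans; ≤-reflexive; 1+n≰n)
open import Data.Fin using (Fin; toℕ; _≟_)
open import Data.Fin.Properties using (toℕ-injective)
open import Data.List using (List; []; _∷_; allFin; length; filter; map)
open import Data.List.Properties using (filter-notAll; length-tabulate)
open import Data.List.Extrema.Nat using (max; xs≤max)
open import Data.List.Membership.Propositional using (_∈_; find; lose)
open import Data.List.Membership.Propositional.Properties using (∈-allFin; ∈-filter⁺; ∈-map⁺)
open import Data.List.Relation.Unary.Any as Any using (Any; here; there; any?)
open import Data.List.Relation.Unary.All as All using (All; []; _∷_; universal)
open import Data.List.Relation.Unary.All.Properties.Core using (¬Any⇒All¬)
open import Data.List.Relation.Unary.AllPairs using ([]; _∷_)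
open import Data.List.Relation.Unary.Unique.Propositional using (Unique)
open import Data.Maybe using (Maybe; just; nothing)
open import Data.Product using (Σ; _×_; _,_; proj₁; proj₂)
open import Data.Sum using (_⊎_; inj₁; inj₂; [_,_]′)
open import Data.Empty using (⊥-elim)
open import Data.Unit using (tt)
open import Function using (_∘_)
open import Relation.Nullary using (¬_; Dec; yes; no)
open import Relation.Nullary.Decidable using (map′; _×-dec_; ¬?)
open import Relation.Binary.PropositionalEquality using (_≡_; _≢_; refl; sym; subst)
open import Relation.Binary.Construct.Closure.ReflexiveTransitive using (Star; ε; _◅_; _◅◅_)

HasStep : Term → Set
HasStep P = Σ Act λ a → Σ Term λ P′ → Step P a P′

𝟏-inert : ¬ HasStep 𝟏
𝟏-inert (_ , _ , ())

⨁ : {X : Set} → (X → Term) → List X → Term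
⨁ g []       = 𝟎
⨁ g (x ∷ xs) = g x ⊕ ⨁ g xs

when : {P : Set} → Dec P → Term → Term
when (yes _) X = X
when (no _)  X = 𝟎

record Additive (Pr : Term → Set) : Set where
  field
    ⊕-introˡ : ∀ {X Y} → Pr X → Pr (X ⊕ Y)
    ⊕-introʳ : ∀ {X Y} → Pr Y → Pr (X ⊕ Y)
    ⊕-elim   : ∀ {X Y} → Pr (X ⊕ Y) → Pr X ⊎ Pr Y
    𝟎-elim   : ¬ Pr 𝟎
open Additive

step-additive : ∀ a P′ → Additive (λ P → Step P a P′)
step-additive a P′ = record { ⊕-introˡ = inj₁ ; ⊕-introʳ = inj₂ ; ⊕-elim = λ s → s ; 𝟎-elim = λ () }

↓-additive : Additive _↓
↓-additive = record { ⊕-introˡ = inj₁ ; ⊕-introʳ = inj₂ ; ⊕-elim = λ t → t ; 𝟎-elim = λ () }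

hasStep-additive : Additive HasStep
hasStep-additive = record
  { ⊕-introˡ = λ { (a , P′ , s) → a , P′ , inj₁ s }
  ; ⊕-introʳ = λ { (a , P′ , s) → a , P′ , inj₂ s }
  ; ⊕-elim   = λ { (a , P′ , inj₁ s) → inj₁ (a , P′ , s) ; (a , P′ , inj₂ s) → inj₂ (a , P′ , s) }
  ; 𝟎-elim   = λ { (_ , _ , ()) }
  }

module _ {Pr : Term → Set} (add : Additive Pr) where

  ⨁⁻ : {X : Set} {g : X → Term} → ∀ xs → Pr (⨁ g xs) → Σ X λ x → x ∈ xs × Pr (g x)
  ⨁⁻ []       p = ⊥-elim (𝟎-elim add p)
  ⨁⁻ (x ∷ xs) p with ⊕-elim add p
  ... | inj₁ q = x , here refl , q
  ... | inj₂ q with ⨁⁻ xs q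
  ... | y , y∈xs , r = y , there y∈xs , r

  ⨁⁺ : {X : Set} {g : X → Term} {x : X} {xs : List X} → x ∈ xs → Pr (g x) → Pr (⨁ g xs)
  ⨁⁺ (here refl) p = ⊕-introˡ add p
  ⨁⁺ (there x∈xs) p = ⊕-introʳ add (⨁⁺ x∈xs p)

  when⁻ : ∀ {P X} (P? : Dec P) → Pr (when P? X) → P × Pr X
  when⁻ (yes p) q = p , q
  when⁻ (no _)  q = ⊥-elim (𝟎-elim add q)

  when⁺ : ∀ {P X} (P? : Dec P) → P → Pr X → Pr (when P? X)
  when⁺ (yes _) _ q = q
  when⁺ (no ¬p) p _ = ⊥-elim (¬p p)

  sumTerm⁻ : ∀ xs → Pr (sumTerm xs) → Σ (Maybe Act) λ x → x ∈ xs × Pr (summand x)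
  sumTerm⁻ []           p = ⊥-elim (𝟎-elim add p)
  sumTerm⁻ (x ∷ [])     p = x , here refl , p
  sumTerm⁻ (x ∷ y ∷ xs) p = [ (λ q → x , here refl , q) , later ∘ sumTerm⁻ (y ∷ xs) ]′ (⊕-elim add p)
    where
    later : ∀ {ys} → Σ (Maybe Act) (λ z → z ∈ ys × Pr (summand z)) →
            Σ (Maybe Act) λ z → z ∈ x ∷ ys × Pr (summand z)
    later (z , z∈ , r) = z , there z∈ , r

  sumTerm⁺ : ∀ {x xs} → x ∈ xs → Pr (summand x) → Pr (sumTerm xs)
  sumTerm⁺ {xs = _ ∷ []}    (here refl) p = p
  sumTerm⁺ {xs = _ ∷ _ ∷ _} (here refl) p = ⊕-introˡ add p
  sumTerm⁺ {xs = _ ∷ _ ∷ _} (there x∈) p = ⊕-introʳ add (sumTerm⁺ x∈ p)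

  sumTerm-dec : (∀ x → Dec (Pr (summand x))) → ∀ xs → Dec (Pr (sumTerm xs))
  sumTerm-dec summand? xs = map′ from to (any? summand? xs)
    where
    from : Any (Pr ∘ summand) xs → Pr (sumTerm xs)
    from any with find any
    ... | _ , x∈ , p = sumTerm⁺ x∈ p
    to : Pr (sumTerm xs) → Any (Pr ∘ summand) xs
    to p with sumTerm⁻ xs p
    ... | _ , x∈ , q = lose x∈ q

module _ {Ok : Act → Set} where

  ⨁-uses : {X : Set} (g : X → Term) (xs : List X) →
           All (UsesOnly Ok ∘ g) xs → UsesOnly Ok (⨁ g xs)
  ⨁-uses g []       []       = tt
  ⨁-uses g (_ ∷ xs) (u ∷ us) = u , ⨁-uses g xs us

  when-uses : ∀ {P X} (P? : Dec P) → UsesOnly Ok X → UsesOnly Ok (when P? X)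
  when-uses (yes _) u = u
  when-uses (no _)  _ = tt

summand-step⁻ : ∀ x {a P} → Step (summand x) a P → x ≡ just a × P ≡ 𝟏
summand-step⁻ (just b) (refl , refl) = refl , refl

summand-↓? : ∀ x → Dec (summand x ↓)
summand-↓? nothing  = yes tt
summand-↓? (just _) = no λ ()

summand-hasStep? : ∀ x → Dec (HasStep (summand x))
summand-hasStep? nothing  = no λ { (_ , _ , ()) }
summand-hasStep? (just a) = yes (a , 𝟏 , refl , refl)

sumTerm-step⁻ : ∀ xs {a P} → Step (sumTerm xs) a P → just a ∈ xs × P ≡ 𝟏
sumTerm-step⁻ xs st with sumTerm⁻ (step-additive _ _) xs st
... | x , x∈ , st′ with summand-step⁻ x st′
... | refl , refl = x∈ , refl

sumTerm-step⁺ : ∀ {xs a} → just a ∈ xs → Step (sumTerm xs) a 𝟏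
sumTerm-step⁺ a∈ = sumTerm⁺ (step-additive _ _) a∈ (refl , refl)

prefixed : Term → Maybe Act → Term
prefixed K nothing  = 𝟎
prefixed K (just a) = a ∙ K

prefixSum : List (Maybe Act) → Term → Term
prefixSum xs K = ⨁ (prefixed K) xs

prefixSum-step⁻ : ∀ xs {K a P} → Step (prefixSum xs K) a P → just a ∈ xs × P ≡ K
prefixSum-step⁻ xs st with ⨁⁻ (step-additive _ _) xs st
... | just _ , a∈ , (refl , refl) = a∈ , refl

prefixSum-step⁺ : ∀ {xs K a} → just a ∈ xs → Step (prefixSum xs K) a K
prefixSum-step⁺ a∈ = ⨁⁺ (step-additive _ _) a∈ (refl , refl)

prefixSum-¬↓ : ∀ xs {K} → ¬ (prefixSum xs K ↓)
prefixSum-¬↓ xs t with ⨁⁻ ↓-additive xs t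
... | nothing , _ , ()
... | just _  , _ , ()

prefixSum-uses : ∀ {A Ok xs K} → (∀ {a} → a ∈ A → Ok a) → All (FromA A) xs →
                 UsesOnly Ok K → UsesOnly Ok (prefixSum xs K)
prefixSum-uses {A} {Ok} {K = K} ok xs-ok uK = ⨁-uses (prefixed K) _ (All.map prefixed-uses xs-ok)
  where
  prefixed-uses : ∀ {x} → FromA A x → UsesOnly Ok (prefixed K x)
  prefixed-uses {nothing} _  = tt
  prefixed-uses {just _}  a∈ = ok a∈ , uK

module Closure {n : ℕ} (Ed : Fin n → Fin n → Set) (Ed? : ∀ i k → Dec (Ed i k))
               (D : Fin n → Term) where

  without : Fin n → List (Fin n) → List (Fin n)
  without k = filter (λ v → ¬? (v ≟ k))

  -- L holds the vertices not yet visited on the current path; fuel ≥ length L suffices.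
  reach : ℕ → List (Fin n) → Fin n → Term
  reach zero    L i = D i
  reach (suc f) L i = D i ⊕ ⨁ (λ k → when (Ed? i k) (reach f (without k L) k)) L

  closure : Fin n → Term
  closure i = reach n (allFin n) i

  reach⁻ : ∀ {Pr} → Additive Pr → ∀ f L i → Pr (reach f L i) →
           Σ (Fin n) λ k → Star Ed i k × Pr (D k)
  reach⁻ add zero    L i p = i , ε , p
  reach⁻ add (suc f) L i p with ⊕-elim add p
  ... | inj₁ q = i , ε , q
  ... | inj₂ q with ⨁⁻ add L q
  ... | k , _ , r with when⁻ add (Ed? i k) r
  ... | e , r′ with reach⁻ add f (without k L) k r′
  ... | k′ , es , d = k′ , e ◅ es , d

  closure⁻ : ∀ {Pr} → Additive Pr → ∀ {i} → Pr (closure i) → Σ (Fin n) λ k → Star Ed i k × Pr (D k)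
  closure⁻ add {i} = reach⁻ add n (allFin n) i

  -- A path from i to k through the listed vertices (i excluded, k included).
  data Path : Fin n → Fin n → List (Fin n) → Set where
    []  : ∀ {i} → Path i i []
    _∷_ : ∀ {i x k vs} → Ed i x → Path x k vs → Path i k (x ∷ vs)

  suffix : ∀ {i k vs y} → Path i k vs → Unique vs → y ∈ vs →
           Σ (List (Fin n)) λ ws → Path y k ws × Unique ws × All (y ≢_) ws
  suffix (_ ∷ p) (y∉ ∷ u) (here refl) = _ , p , u , y∉
  suffix (_ ∷ p) (_ ∷ u)  (there y∈)  = suffix p u y∈

  simple : ∀ {i k} → Star Ed i k → Σ (List (Fin n)) λ vs → Path i k vs × Unique vs
  simple ε = [] , [] , []
  simple (_◅_ {j = x} e es) with simple es
  ... | vs , p , u with any? (x ≟_) vs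
  ... | yes x∈ = let ws , p′ , u′ , x∉ = suffix p u x∈ in x ∷ ws , e ∷ p′ , x∉ ∷ u′
  ... | no x∉  = x ∷ vs , e ∷ p , ¬Any⇒All¬ vs x∉ ∷ u

  reach⁺ : ∀ {Pr} → Additive Pr → ∀ f L {i k vs} → Path i k vs → Unique vs → All (_∈ L) vs →
           length L ≤ f → Pr (D k) → Pr (reach f L i)
  reach⁺ add zero    L       []      _ _ _ d = d
  reach⁺ add (suc f) L       []      _ _ _ d = ⊕-introˡ add d
  reach⁺ add zero    []      (_ ∷ _) _ (() ∷ _) _ d
  reach⁺ add zero    (_ ∷ _) (_ ∷ _) _ _ () d
  reach⁺ add (suc f) L {i} (_∷_ {x = x} {vs = vs} e p) (x∉ ∷ u) (x∈ ∷ vs⊆L) L≤ d =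
    ⊕-introʳ add (⨁⁺ add x∈ (when⁺ add (Ed? i x) e (reach⁺ add f (without x L) p u vs⊆L′ L′≤ d)))
    where
    vs⊆L′ : All (_∈ without x L) vs
    vs⊆L′ = All.tabulate λ v∈ →
      ∈-filter⁺ (λ v → ¬? (v ≟ x)) (All.lookup vs⊆L v∈) (λ v≡x → All.lookup x∉ v∈ (sym v≡x))
    L′≤ : length (without x L) ≤ f
    L′≤ = s≤s⁻¹ (≤-trans (filter-notAll (λ v → ¬? (v ≟ x)) L x∈′) L≤)
      where x∈′ = Any.map (λ x≡v v≢x → v≢x (sym x≡v)) x∈

  closure⁺ : ∀ {Pr} → Additive Pr → ∀ {i k} → Star Ed i k → Pr (D k) → Pr (closure i)
  closure⁺ add es d with simple es
  ... | vs , p , u = reach⁺ add n (allFin n) p u (All.tabulate λ {v} _ → ∈-allFin v)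
                       (≤-reflexive (length-tabulate (λ v → v))) d

  closure-uses : ∀ {Ok} → (∀ k → UsesOnly Ok (D k)) → ∀ i → UsesOnly Ok (closure i)
  closure-uses {Ok} D-uses = reach-uses n (allFin n)
    where
    reach-uses : ∀ f L i → UsesOnly Ok (reach f L i)
    reach-uses zero    L i = D-uses i
    reach-uses (suc f) L i =
      D-uses i , ⨁-uses _ L (universal (λ k → when-uses (Ed? i k) (reach-uses f (without k L) k)) L)

module Specification {A : List Act} {n : ℕ} (E : RegSpec A n) where
  open RegSpec E public
  open SpecSem rhs public

  -- By the negative premise of •, P_i inherits the transitions of P_j exactly along such edges.
  Transparent : Fin n → Fin n → Set
  Transparent i j = sumTerm (α i j) ↓ × ¬ HasStep (sumTerm (α i j))

  transparent? : ∀ i j → Dec (Transparent i j)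
  transparent? i j = sumTerm-dec ↓-additive summand-↓? (α i j)
                 ×-dec ¬? (sumTerm-dec hasStep-additive summand-hasStep? (α i j))

  Nullable : Fin n → Fin n → Set
  Nullable i j = sumTerm (α i j) ↓

  nullable? : ∀ i j → Dec (Nullable i j)
  nullable? i j = sumTerm-dec ↓-additive summand-↓? (α i j)

  terminates? : ∀ k → Dec (sumTerm (β k) ↓)
  terminates? k = sumTerm-dec ↓-additive summand-↓? (β k)

  data Move (k : Fin n) (a : Act) : STerm n → Set where
    via-α : ∀ j → just a ∈ α k j → Move k a (𝟏 ⊙ name j)
    via-β : just a ∈ β k → Move k a (cl 𝟏)

  move-A : ∀ {k a s} → Move k a s → a ∈ A
  move-A (via-α j a∈) = All.lookup (α-ok _ j) a∈
  move-A (via-β a∈)   = All.lookup (β-ok _) a∈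

  mutual
    name-step⁻ : ∀ {i a s} → Stepₛ (name i) a s → Σ (Fin n) λ k → Star Transparent i k × Move k a s
    name-step⁻ (name-step d) = sumFrom-step⁻ (allFin n) d

    sumFrom-step⁻ : ∀ {i} js {a s} → Stepₛ (sumFrom i js) a s →
                    Σ (Fin n) λ k → Star Transparent i k × Move k a s
    sumFrom-step⁻ {i} [] (cl-step st) with sumTerm-step⁻ (β i) st
    ... | a∈ , refl = i , ε , via-β a∈
    sumFrom-step⁻ {i} (j ∷ _) (sum-l (seq-l st)) with sumTerm-step⁻ (α i j) st
    ... | a∈ , refl = i , ε , via-α j a∈
    sumFrom-step⁻ (_ ∷ _) (sum-l (seq-r t inert d)) with name-step⁻ d
    ... | k , es , mv = k , (t , inert) ◅ es , mv
    sumFrom-step⁻ (_ ∷ js) (sum-r d) = sumFrom-step⁻ js d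

  sumFrom-α : ∀ {i j js a s} → j ∈ js → Stepₛ (sumTerm (α i j) ⊙ name j) a s → Stepₛ (sumFrom i js) a s
  sumFrom-α (here refl) d = sum-l d
  sumFrom-α (there j∈)  d = sum-r (sumFrom-α j∈ d)

  sumFrom-β : ∀ {i a s} js → Stepₛ (cl (sumTerm (β i))) a s → Stepₛ (sumFrom i js) a s
  sumFrom-β []       d = d
  sumFrom-β (_ ∷ js) d = sum-r (sumFrom-β js d)

  name-step⁺ : ∀ {i k a s} → Star Transparent i k → Move k a s → Stepₛ (name i) a s
  name-step⁺ ε (via-α j a∈) = name-step (sumFrom-α (∈-allFin j) (seq-l (sumTerm-step⁺ a∈)))
  name-step⁺ ε (via-β a∈)   = name-step (sumFrom-β (allFin n) (cl-step (sumTerm-step⁺ a∈)))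
  name-step⁺ (_◅_ {j = x} (t , inert) es) mv =
    name-step (sumFrom-α (∈-allFin x) (seq-r t inert (name-step⁺ es mv)))

  name-step-A : ∀ {i a s} → Stepₛ (name i) a s → a ∈ A
  name-step-A d = move-A (proj₂ (proj₂ (name-step⁻ d)))

  mutual
    name-↓⁻ : ∀ {i} → name i ↓ₛ → Σ (Fin n) λ k → Star Nullable i k × sumTerm (β k) ↓
    name-↓⁻ (name↓ t) = sumFrom-↓⁻ (allFin n) t

    sumFrom-↓⁻ : ∀ {i} js → sumFrom i js ↓ₛ → Σ (Fin n) λ k → Star Nullable i k × sumTerm (β k) ↓
    sumFrom-↓⁻ {i} []       (cl↓ t) = i , ε , t
    sumFrom-↓⁻ (_ ∷ _)  (suml↓ (seq↓ t u)) with name-↓⁻ u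
    ... | k , es , t′ = k , t ◅ es , t′
    sumFrom-↓⁻ (_ ∷ js) (sumr↓ t) = sumFrom-↓⁻ js t

  sumFrom-↓α : ∀ {i j js} → j ∈ js → (sumTerm (α i j) ⊙ name j) ↓ₛ → sumFrom i js ↓ₛ
  sumFrom-↓α (here refl) t = suml↓ t
  sumFrom-↓α (there j∈)  t = sumr↓ (sumFrom-↓α j∈ t)

  sumFrom-↓β : ∀ {i} js → cl (sumTerm (β i)) ↓ₛ → sumFrom i js ↓ₛ
  sumFrom-↓β []       t = t
  sumFrom-↓β (_ ∷ js) t = sumr↓ (sumFrom-↓β js t)

  name-↓⁺ : ∀ {i k} → Star Nullable i k → sumTerm (β k) ↓ → name i ↓ₛ
  name-↓⁺ ε t = name↓ (sumFrom-↓β (allFin n) (cl↓ t))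
  name-↓⁺ (_◅_ {j = x} t es) u = name↓ (sumFrom-↓α (∈-allFin x) (seq↓ t (name-↓⁺ es u)))

module Construction {A : List Act} {n : ℕ} (E : RegSpec A n) (c : Chan) (c-fresh : FreshChan c A) where
  open Specification E

  send : Fin n → Term
  send j = snd c (toℕ j) ∙ 𝟏

  initials : Fin n → Term
  initials k = ⨁ (λ j → prefixSum (α k j) (send j)) (allFin n) ⊕ prefixSum (β k) 𝟏

  accepting : Fin n → Term
  accepting k = when (terminates? k) 𝟏

  module Steps = Closure Transparent transparent? initials
  module Terms = Closure Nullable nullable? accepting

  Body : Fin n → Term
  Body i = Steps.closure i ⊕ Terms.closure i

  data _≅_ : Term → STerm n → Set where
    sent : ∀ j → send j ≅ (𝟏 ⊙ name j)
    done : 𝟏 ≅ cl 𝟏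

  initials-step⁻ : ∀ {k a X} → Step (initials k) a X → Σ (STerm n) λ s → Move k a s × X ≅ s
  initials-step⁻ {k} (inj₁ st) with ⨁⁻ (step-additive _ _) (allFin n) st
  ... | j , _ , st′ with prefixSum-step⁻ (α k j) st′
  ... | a∈ , refl = _ , via-α j a∈ , sent j
  initials-step⁻ {k} (inj₂ st) with prefixSum-step⁻ (β k) st
  ... | a∈ , refl = _ , via-β a∈ , done

  initials-step⁺ : ∀ {k a s} → Move k a s → Σ Term λ X → Step (initials k) a X × X ≅ s
  initials-step⁺ (via-α j a∈) =
    send j , inj₁ (⨁⁺ (step-additive _ _) (∈-allFin j) (prefixSum-step⁺ a∈)) , sent j
  initials-step⁺ (via-β a∈) = 𝟏 , inj₂ (prefixSum-step⁺ a∈) , done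

  initials-¬↓ : ∀ k → ¬ (initials k ↓)
  initials-¬↓ k (inj₁ t) with ⨁⁻ ↓-additive (allFin n) t
  ... | j , _ , t′ = prefixSum-¬↓ (α k j) t′
  initials-¬↓ k (inj₂ t) = prefixSum-¬↓ (β k) t

  Body-step⁻ : ∀ {i a X} → Step (Body i) a X → Σ (STerm n) λ s → Stepₛ (name i) a s × X ≅ s
  Body-step⁻ (inj₁ st) with Steps.closure⁻ (step-additive _ _) st
  ... | k , es , st′ with initials-step⁻ st′
  ... | s , mv , r = s , name-step⁺ es mv , r
  Body-step⁻ (inj₂ st) with Terms.closure⁻ (step-additive _ _) st
  ... | k , _ , st′ with when⁻ (step-additive _ _) (terminates? k) st′
  ... | _ , ()

  Body-step⁺ : ∀ {i a s} → Stepₛ (name i) a s → Σ Term λ X → Step (Body i) a X × X ≅ s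
  Body-step⁺ d with name-step⁻ d
  ... | k , es , mv with initials-step⁺ mv
  ... | X , st , r = X , inj₁ (Steps.closure⁺ (step-additive _ _) es st) , r

  Body-step-A : ∀ {i a X} → Step (Body i) a X → a ∈ A
  Body-step-A st = name-step-A (proj₁ (proj₂ (Body-step⁻ st)))

  Body-↓⁻ : ∀ {i} → Body i ↓ → name i ↓ₛ
  Body-↓⁻ (inj₁ t) with Steps.closure⁻ ↓-additive t
  ... | k , _ , t′ = ⊥-elim (initials-¬↓ k t′)
  Body-↓⁻ (inj₂ t) with Terms.closure⁻ ↓-additive t
  ... | k , es , t′ = name-↓⁺ es (proj₁ (when⁻ ↓-additive (terminates? k) t′))

  Body-↓⁺ : ∀ {i} → name i ↓ₛ → Body i ↓
  Body-↓⁺ t with name-↓⁻ t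
  ... | k , es , u = inj₂ (Terms.closure⁺ ↓-additive es (when⁺ ↓-additive (terminates? k) u tt))

  listen : (Fin n → Term) → Term
  listen g = ⨁ (λ k → rcv c (toℕ k) ∙ g k) (allFin n)

  control : Term
  control = listen Body

  register : Term
  register = listen send

  ⟪_,_⟫ : Term → Term → Term
  ⟪ X , Y ⟫ = par (c ∷ []) (X • control *) (Y • register *)

  Q : Fin n → Term
  Q i = ⟪ Body i , 𝟏 ⟫

  on-c : ∀ {a} → a ∈ A → ¬ InI (c ∷ []) a
  on-c a∈ (_ , here refl , d , inj₁ refl) = proj₁ (c-fresh d) a∈
  on-c a∈ (_ , here refl , d , inj₂ refl) = proj₂ (c-fresh d) a∈
  on-c a∈ (_ , there () , _)

  rcv-on-c : ∀ d → InI (c ∷ []) (rcv c d)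
  rcv-on-c d = c , here refl , d , inj₁ refl

  snd-on-c : ∀ d → InI (c ∷ []) (snd c d)
  snd-on-c d = c , here refl , d , inj₂ refl

  rcv-injective : ∀ {d e} → rcv c d ≡ rcv c e → d ≡ e
  rcv-injective refl = refl

  data LoopStep (X : Term) (g : Fin n → Term) (a : Act) : Term → Set where
    inner    : ∀ {X′} → Step X a X′ → LoopStep X g a (X′ • listen g *)
    listened : X ↓ → ∀ k → a ≡ rcv c (toℕ k) → LoopStep X g a (g k • listen g *)

  loop-step⁻ : ∀ {X g a Y} → Step (X • listen g *) a Y → LoopStep X g a Y
  loop-step⁻ (inj₁ (_ , st , refl)) = inner st
  loop-step⁻ (inj₂ (t , _ , _ , st , refl)) with ⨁⁻ (step-additive _ _) (allFin n) st
  ... | k , _ , (refl , refl) = listened t k refl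

  control-step⁻ : ∀ X {a Y} → Step (X • control *) a Y → LoopStep X Body a Y
  control-step⁻ X = loop-step⁻

  register-step⁻ : ∀ X {a Y} → Step (X • register *) a Y → LoopStep X send a Y
  register-step⁻ X = loop-step⁻

  resume-step : ∀ {g} k → Step (𝟏 • listen g *) (rcv c (toℕ k)) (g k • listen g *)
  resume-step k = inj₂ (tt , 𝟏-inert , _ , ⨁⁺ (step-additive _ _) (∈-allFin k) (refl , refl) , refl)

  running-step⁻ : ∀ {i a Y} → Step ⟪ Body i , 𝟏 ⟫ a Y →
                  Σ Term λ X → Step (Body i) a X × Y ≡ ⟪ X , 𝟏 ⟫
  running-step⁻ {i} (inj₁ (_ , stL , ¬I , refl)) with control-step⁻ (Body i) stL
  ... | inner st          = _ , st , refl
  ... | listened _ _ refl = ⊥-elim (¬I (rcv-on-c _))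
  running-step⁻ (inj₂ (inj₁ (_ , stR , ¬I , refl))) with register-step⁻ 𝟏 stR
  ... | inner ()
  ... | listened _ _ refl = ⊥-elim (¬I (rcv-on-c _))
  running-step⁻ (inj₂ (inj₂ (refl , _ , _ , _ , _ , _ , inj₁ (_ , stR) , refl)))
    with register-step⁻ 𝟏 stR
  ... | inner ()
  ... | listened _ _ ()
  running-step⁻ {i} (inj₂ (inj₂ (refl , _ , here refl , d , _ , _ , inj₂ (stL , _) , refl)))
    with control-step⁻ (Body i) stL
  ... | inner st        = ⊥-elim (proj₂ (c-fresh d) (Body-step-A st))
  ... | listened _ _ ()
  running-step⁻ (inj₂ (inj₂ (refl , _ , there () , _)))

  running-step⁺ : ∀ {i a X} → Step (Body i) a X → Step ⟪ Body i , 𝟏 ⟫ a ⟪ X , 𝟏 ⟫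
  running-step⁺ st = inj₁ (_ , inj₁ (_ , st , refl) , on-c (Body-step-A st) , refl)

  sending-step⁻ : ∀ {j a Y} → Step ⟪ send j , 𝟏 ⟫ a Y → a ≡ τ × Y ≡ ⟪ 𝟏 , send j ⟫
  sending-step⁻ {j} (inj₁ (_ , stL , ¬I , refl)) with control-step⁻ (send j) stL
  ... | inner (refl , refl) = ⊥-elim (¬I (snd-on-c _))
  ... | listened () _ _
  sending-step⁻ (inj₂ (inj₁ (_ , stR , ¬I , refl))) with register-step⁻ 𝟏 stR
  ... | inner ()
  ... | listened _ _ refl = ⊥-elim (¬I (rcv-on-c _))
  sending-step⁻ {j} (inj₂ (inj₂ (refl , _ , _ , _ , _ , _ , inj₁ (stL , _) , refl)))
    with control-step⁻ (send j) stL
  ... | inner (() , _)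
  ... | listened () _ _
  sending-step⁻ {j} (inj₂ (inj₂ (refl , _ , _ , _ , _ , _ , inj₂ (stL , stR) , refl)))
    with control-step⁻ (send j) stL
  ... | listened () _ _
  ... | inner (refl , refl) with register-step⁻ 𝟏 stR
  ...   | inner ()
  ...   | listened _ k e with toℕ-injective (rcv-injective e)
  ...     | refl = refl , refl

  sending-step⁺ : ∀ {j} → Step ⟪ send j , 𝟏 ⟫ τ ⟪ 𝟏 , send j ⟫
  sending-step⁺ {j} =
    inj₂ (inj₂ (refl , c , here refl , toℕ j , _ , _ ,
                inj₂ (inj₁ (𝟏 , (refl , refl) , refl) , resume-step j) , refl))

  echoing-step⁻ : ∀ {j a Y} → Step ⟪ 𝟏 , send j ⟫ a Y → a ≡ τ × Y ≡ ⟪ Body j , 𝟏 ⟫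
  echoing-step⁻ (inj₁ (_ , stL , ¬I , refl)) with control-step⁻ 𝟏 stL
  ... | inner ()
  ... | listened _ _ refl = ⊥-elim (¬I (rcv-on-c _))
  echoing-step⁻ {j} (inj₂ (inj₁ (_ , stR , ¬I , refl))) with register-step⁻ (send j) stR
  ... | inner (refl , refl) = ⊥-elim (¬I (snd-on-c _))
  ... | listened () _ _
  echoing-step⁻ {j} (inj₂ (inj₂ (refl , _ , _ , _ , _ , _ , inj₁ (stL , stR) , refl)))
    with register-step⁻ (send j) stR
  ... | listened () _ _
  ... | inner (refl , refl) with control-step⁻ 𝟏 stL
  ...   | inner ()
  ...   | listened _ k e with toℕ-injective (rcv-injective e)
  ...     | refl = refl , refl
  echoing-step⁻ (inj₂ (inj₂ (refl , _ , _ , _ , _ , _ , inj₂ (stL , _) , refl)))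
    with control-step⁻ 𝟏 stL
  ... | inner ()
  ... | listened _ _ ()

  echoing-step⁺ : ∀ {j} → Step ⟪ 𝟏 , send j ⟫ τ ⟪ Body j , 𝟏 ⟫
  echoing-step⁺ {j} =
    inj₂ (inj₂ (refl , c , here refl , toℕ j , _ , _ ,
                inj₁ (resume-step j , inj₁ (𝟏 , (refl , refl) , refl)) , refl))

  idle-step⁻ : ∀ {a Y} → ¬ Step ⟪ 𝟏 , 𝟏 ⟫ a Y
  idle-step⁻ (inj₁ (_ , stL , ¬I , refl)) with control-step⁻ 𝟏 stL
  ... | inner ()
  ... | listened _ _ refl = ¬I (rcv-on-c _)
  idle-step⁻ (inj₂ (inj₁ (_ , stR , ¬I , refl))) with register-step⁻ 𝟏 stR
  ... | inner ()
  ... | listened _ _ refl = ¬I (rcv-on-c _)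
  idle-step⁻ (inj₂ (inj₂ (refl , _ , _ , _ , _ , _ , inj₁ (_ , stR) , refl))) with register-step⁻ 𝟏 stR
  ... | inner ()
  ... | listened _ _ ()
  idle-step⁻ (inj₂ (inj₂ (refl , _ , _ , _ , _ , _ , inj₂ (stL , _) , refl))) with control-step⁻ 𝟏 stL
  ... | inner ()
  ... | listened _ _ ()

  -- The index counts the inert τ-steps left before control runs Body j again.
  data Phase (j : Fin n) : ℕ → Term → Set where
    running : Phase j 0 ⟪ Body j , 𝟏 ⟫
    echoing : Phase j 1 ⟪ 𝟏 , send j ⟫
    sending : Phase j 2 ⟪ send j , 𝟏 ⟫

  transient-step⁻ : ∀ {j d P a P′} → Phase j (suc d) P → Step P a P′ → a ≡ τ × Phase j d P′
  transient-step⁻ echoing st with echoing-step⁻ st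
  ... | refl , refl = refl , running
  transient-step⁻ sending st with sending-step⁻ st
  ... | refl , refl = refl , echoing

  transient-step⁺ : ∀ {j d P} → Phase j (suc d) P → Σ Term λ P′ → Step P τ P′ × Phase j d P′
  transient-step⁺ echoing = _ , echoing-step⁺ , running
  transient-step⁺ sending = _ , sending-step⁺ , echoing

  open DPBB Stepₛ _↓ₛ

  settle : ∀ {j} d {P} → Phase j d P → cl P ⇾* cl ⟪ Body j , 𝟏 ⟫
  settle zero    running = ε
  settle (suc d) ph with transient-step⁺ ph
  ... | _ , st , ph′ = cl-step st ◅ settle d ph′

  data AtState (j : Fin n) : STerm n → Set where
    at-name    : AtState j (name j)
    at-resumed : AtState j (𝟏 ⊙ name j)

  at-step⁻ : ∀ {j s a s′} → AtState j s → Stepₛ s a s′ → Stepₛ (name j) a s′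
  at-step⁻ at-name    d             = d
  at-step⁻ at-resumed (seq-l ())
  at-step⁻ at-resumed (seq-r _ _ d) = d

  at-step⁺ : ∀ {j s a s′} → AtState j s → Stepₛ (name j) a s′ → Stepₛ s a s′
  at-step⁺ at-name    d = d
  at-step⁺ at-resumed d = seq-r tt 𝟏-inert d

  at-↓⁻ : ∀ {j s} → AtState j s → s ↓ₛ → name j ↓ₛ
  at-↓⁻ at-name    t          = t
  at-↓⁻ at-resumed (seq↓ _ t) = t

  at-↓⁺ : ∀ {j s} → AtState j s → name j ↓ₛ → s ↓ₛ
  at-↓⁺ at-name    t = t
  at-↓⁺ at-resumed t = seq↓ tt t

  data Tracks : STerm n → STerm n → Set where
    active   : ∀ {j d s P} → AtState j s → Phase j d P → Tracks s (cl P)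
    finished : Tracks (cl 𝟏) (cl ⟪ 𝟏 , 𝟏 ⟫)

  Matched : STerm n → STerm n → Set
  Matched s t = Tracks s t ⊎ Tracks t s

  residual : ∀ {X s} → X ≅ s → Tracks s (cl ⟪ X , 𝟏 ⟫)
  residual (sent j) = active at-resumed sending
  residual done     = finished

  match : ∀ {j s a s′} → AtState j s → Stepₛ s a s′ →
          Σ Term λ P′ → Step ⟪ Body j , 𝟏 ⟫ a P′ × Tracks s′ (cl P′)
  match at d with Body-step⁺ (at-step⁻ at d)
  ... | X , st , r = ⟪ X , 𝟏 ⟫ , running-step⁺ st , residual r

  answer : ∀ {j s a P′} → AtState j s → Step ⟪ Body j , 𝟏 ⟫ a P′ →
           Σ (STerm n) λ s′ → Stepₛ s a s′ × Tracks s′ (cl P′)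
  answer at st with running-step⁻ st
  ... | X , st′ , refl with Body-step⁻ st′
  ... | s′ , d , r = s′ , at-step⁺ at d , residual r

  simulate : ∀ {s t a s′} → Tracks s t → Stepₛ s a s′ →
             Σ (STerm n) λ t″ → Σ (STerm n) λ t′ → t ⇾* t″ × Stepₛ t″ a t′ ×
               Matched s t″ × Matched s′ t′
  simulate (active {d = d} at ph) d′ with match at d′
  ... | _ , st , tr = _ , _ , settle d ph , cl-step st , inj₁ (active at running) , inj₁ tr
  simulate finished (cl-step ())

  respond : ∀ {s t a s′} → Tracks t s → Stepₛ s a s′ →
            Σ (STerm n) λ t″ → Σ (STerm n) λ t′ → t ⇾* t″ × (Stepₛ t″ a t′ ⊎ (a ≡ τ × t″ ≡ t′)) ×
              Matched s t″ × Matched s′ t′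
  respond (active at running) (cl-step st) with answer at st
  ... | t′ , d , tr = _ , t′ , ε , inj₁ d , inj₂ (active at running) , inj₂ tr
  respond (active {d = suc _} at ph) (cl-step st) with transient-step⁻ ph st
  ... | refl , ph′ = _ , _ , ε , inj₂ (refl , refl) , inj₂ (active at ph) , inj₂ (active at ph′)
  respond finished (cl-step st) = ⊥-elim (idle-step⁻ st)

  simulate-↓ : ∀ {s t} → Tracks s t → s ↓ₛ →
               Σ (STerm n) λ t′ → t ⇾* t′ × t′ ↓ₛ × Matched s t′
  simulate-↓ (active {d = d} at ph) t =
    _ , settle d ph , cl↓ ((Body-↓⁺ (at-↓⁻ at t) , tt) , (tt , tt)) , inj₁ (active at running)
  simulate-↓ finished _ = _ , ε , cl↓ ((tt , tt) , (tt , tt)) , inj₁ finished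

  respond-↓ : ∀ {s t} → Tracks t s → s ↓ₛ →
              Σ (STerm n) λ t′ → t ⇾* t′ × t′ ↓ₛ × Matched s t′
  respond-↓ (active at running) (cl↓ ((t , _) , _)) =
    _ , ε , at-↓⁺ at (Body-↓⁻ t) , inj₂ (active at running)
  respond-↓ (active at echoing) (cl↓ (_ , (() , _)))
  respond-↓ (active at sending) (cl↓ ((() , _) , _))
  respond-↓ finished _ = _ , ε , cl↓ tt , inj₂ finished

  cl-step⁻ : ∀ {P a s} → Stepₛ (cl P) a s → Σ Term λ P′ → s ≡ cl P′ × Step P a P′
  cl-step⁻ (cl-step st) = _ , refl , st

  ⇾*-⇾⁺ : ∀ {s t u} → s ⇾* t → t ⇾ u → s ⇾⁺ u
  ⇾*-⇾⁺ ε         st = _ , st , ε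
  ⇾*-⇾⁺ (st′ ◅ p) st = _ , st′ , p ◅◅ (st ◅ ε)

  module Divergence (f : ℕ → STerm n) (f-τ : ∀ k → f k ⇾ f (suc k)) where

    Escapes : STerm n → Set
    Escapes t = Σ (STerm n) λ t′ → t ⇾⁺ t′ × Σ ℕ λ k → Matched (f k) t′

    next : ∀ {m P} → f m ≡ cl P → Σ Term λ P′ → f (suc m) ≡ cl P′ × Step P τ P′
    next {m} eq = cl-step⁻ (subst (λ s → s ⇾ f (suc m)) eq (f-τ m))

    -- A diverging process must pass through running within d steps, and its next τ-step is
    -- mirrored by the specification.
    chase : ∀ d {j t P} m → AtState j t → Phase j d P → f m ≡ cl P → Escapes t
    chase zero m at running eq with next eq
    ... | _ , eq′ , st with answer at st
    ... | t′ , d , tr = t′ , (t′ , d , ε) , suc m , inj₂ (subst (Tracks t′) (sym eq′) tr)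
    chase (suc d) m at ph eq with next eq
    ... | _ , eq′ , st = chase d (suc m) at (proj₂ (transient-step⁻ ph st)) eq′

    diverge : ∀ {s t} → Matched s t → f zero ≡ s → Escapes t
    diverge (inj₁ tr) refl with simulate tr (f-τ 0)
    ... | _ , t′ , p , st , _ , r = t′ , ⇾*-⇾⁺ p st , 1 , r
    diverge (inj₂ (active {d = d} at ph)) eq = chase d 0 at ph eq
    diverge (inj₂ finished) eq = ⊥-elim (idle-step⁻ (proj₂ (proj₂ (next eq))))

  Matched-isDPBB : IsDPBB Matched
  Matched-isDPBB = record
    { symm = λ { (inj₁ tr) → inj₂ tr ; (inj₂ tr) → inj₁ tr }
    ; step = λ { (inj₁ tr) d → let t″ , t′ , p , st , r = simulate tr d in t″ , t′ , p , inj₁ st , r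
               ; (inj₂ tr) d → respond tr d }
    ; term = λ { (inj₁ tr) → simulate-↓ tr ; (inj₂ tr) → respond-↓ tr }
    ; div  = λ r f f0 f-τ _ → Divergence.diverge f f-τ r f0
    }

  name≈Q : ∀ i → name i ≈ cl (Q i)
  name≈Q i = Matched , Matched-isDPBB , inj₁ (active at-name running)

  Allowed : Act → Set
  Allowed a = a ∈ A ⊎ OnChan c a

  send-uses : ∀ j → UsesOnly Allowed (send j)
  send-uses j = inj₂ (toℕ j , inj₂ refl) , tt

  initials-uses : ∀ k → UsesOnly Allowed (initials k)
  initials-uses k = ⨁-uses _ (allFin n) (universal (λ j → prefixSum-uses inj₁ (α-ok k j) (send-uses j)) _)
                  , prefixSum-uses inj₁ (β-ok k) tt

  Body-uses : ∀ i → UsesOnly Allowed (Body i)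
  Body-uses i = Steps.closure-uses initials-uses i
              , Terms.closure-uses (λ k → when-uses (terminates? k) tt) i

  listen-uses : ∀ {g} → (∀ k → UsesOnly Allowed (g k)) → UsesOnly Allowed (listen g)
  listen-uses g-uses = ⨁-uses _ (allFin n) (universal (λ k → inj₂ (toℕ k , inj₁ refl) , g-uses k) _)

  Q-uses : ∀ i → UsesOnly Allowed (Q i)
  Q-uses i = (Body-uses i , listen-uses Body-uses) , (tt , listen-uses send-uses)

chanOf : Act → Chan
chanOf (rcv c _) = c
chanOf (snd c _) = c
chanOf _         = 0

freshChan : List Act → Chan
freshChan A = suc (max 0 (map chanOf A))

freshChan-fresh : ∀ A → FreshChan (freshChan A) A
freshChan-fresh A d = 1+n≰n ∘ bounded , 1+n≰n ∘ bounded
  where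
  bounded : ∀ {a} → a ∈ A → chanOf a ≤ max 0 (map chanOf A)
  bounded a∈ = All.lookup (xs≤max 0 (map chanOf A)) (∈-map⁺ chanOf a∈)

lemma4 : (A : List Act) → τ ∈ A → (n : ℕ) → (E : RegSpec A n) → (i : Fin n) →
         Σ Chan λ c → FreshChan c A × Σ Term λ Q →
           UsesOnly (λ a → a ∈ A ⊎ OnChan c a) Q × Bisim E (name i) (cl Q)
lemma4 A _ n E i = freshChan A , freshChan-fresh A , Q i , Q-uses i , name≈Q i
  where open Construction E (freshChan A) (freshChan-fresh A)
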